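{- Let $\rho=\langle\pi,s_0,\dots,s_{n(\rho)-1}\rangle\in S$ and $j>i(\rho)$. Then there are $t_0,\dots,t_{n(\rho)-1}\in 2^{n_j}$ such that $s_k\vartriangleleft t_k$ for all $k<n(\rho)$ and $\langle\pi,t_0,\dots,t_{n(\rho)-1}\rangle\in S$. Moreover, if $j$ is sufficiently large, $t_0,\dots,t_{n(\rho)-1}$ can be chosen pairwise distinct.
   Context: $2^\omega$ carries coordinatewise addition mod 2, written $+$; the same $+$ denotes coordinatewise addition mod 2 of 0-1 sequences with the same domain. For sequences, $s\vartriangleleft t$ means $t$ properly extends $s$. Fix integers $0=n_0<n_1<n_2<\cdots$ and sets $C_i\subseteq 2^{[n_i,n_{i+1})}$ ($i\in\omega$) such that for every $i$ and all $s_0,\dots,s_{n_i}\in 2^{[n_i,n_{i+1})}$ both $\bigcap_{k\le n_i}(C_i+s_k)$ and $\bigcap_{k\le n_i}((2^{[n_i,n_{i+1})}\setminus C_i)+s_k)$ are nonempty. Fix a sequence $\langle P_m:m\in\omega\rangle$ of nonempty perfect subsets of $2^\omega$ and let $T^*_m=\{z\upharpoonright k: z\in P_m+P_m,\ k\in\omega\}$, where $P_m+P_m=\{x+y:x,y\in P_m\}$. A tree mapping with domain $n\ge 1$ consists of a tree ordering $\prec$ on $\{0,\dots,n-1\}$ (a partial order in which the predecessors of each element are linearly ordered) such that $k\prec\ell$ implies $k<\ell$, together with a function $\pi$ into $\omega$ defined exactly on the pairs $(k,\ell)$ such that $k$ is the immediate $\prec$-predecessor of $\ell$. A finite sequence $s$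 is acceptable if $\mathrm{dom}(s)=n_i$ for some $i$ and $s\upharpoonright[n_j,n_{j+1})\in C_j$ for all $j<i$. $S$ is the set of all tuples $\rho=\langle\pi,s_0,\dots,s_{n-1}\rangle$ with $n\ge1$, $\pi$ a tree mapping with domain $n$, all $s_k$ acceptable with a common domain $n_i$ where $n_i\ge n$, and $s_k+s_\ell\in T^*_{\pi(k,\ell)}$ whenever $\pi(k,\ell)$ is defined; we write $n(\rho)=n$ and $i(\rho)=i$. -}

module Defs where

open import Data.Nat using (ℕ; zero; suc; _+_; _∸_; _≤_; _<_; z≤n; s≤s)
open import Data.Nat.Properties
  using (≤-refl; ≤-trans; <⇒≤; ≤-pred; m≤n⇒m<n∨m≡n; +-monoʳ-<; m+[n∸m]≡n; <-≤-trans)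
open import Data.Bool using (Bool; _xor_; T)
open import Data.Fin using (Fin; toℕ; fromℕ<; inject≤)
open import Data.Fin.Properties using (toℕ<n)
open import Data.Vec using (Vec; lookup; tabulate; zipWith)
open import Data.Product using (Σ; _×_; _,_)
open import Data.Sum using (_⊎_; inj₁; inj₂)
open import Relation.Nullary using (¬_)
open import Relation.Binary.PropositionalEquality using (_≡_; refl; subst)

Cantor : Set
Cantor = ℕ → Bool

Seq : ℕ → Set
Seq d = Vec Bool d

_⊕_ : ∀ {d} → Seq d → Seq d → Seq d
_⊕_ = zipWith _xor_

-- the sequence of elements of 2^[n_i, n_(i+1)), coded as vectors of length n_(i+1) ∸ n_i
Block : (ℕ → ℕ) → ℕ → Set
Block N i = Seq (N (suc i) ∸ N i)

mono : (N : ℕ → ℕ) → (∀ i → N i < N (suc i)) → ∀ {a b} → a ≤ b → N a ≤ N b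
mono N inc {a} {zero} z≤n = ≤-refl
mono N inc {a} {suc b} p with m≤n⇒m<n∨m≡n p
... | inj₁ a<sb = ≤-trans (mono N inc (≤-pred a<sb)) (<⇒≤ (inc b))
... | inj₂ refl = ≤-refl

slice-lemma : ∀ a b d (m : Fin (b ∸ a)) → a ≤ b → b ≤ d → a + toℕ m < d
slice-lemma a b d m a≤b b≤d =
  <-≤-trans (subst (λ x → a + toℕ m < x) (m+[n∸m]≡n a≤b) (+-monoʳ-< a (toℕ<n m))) b≤d

-- s ↾ [a,b) for s with domain d ≥ b, reindexed to start at 0
slice : ∀ {d} → Seq d → (a b : ℕ) → a ≤ b → b ≤ d → Seq (b ∸ a)
slice {d} s a b a≤b b≤d = tabulate (λ m → lookup s (fromℕ< (slice-lemma a b d m a≤b b≤d)))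

Closed : (Cantor → Set) → Set
Closed P = ∀ x → (∀ k → Σ Cantor λ y → P y × (∀ m → m < k → y m ≡ x m)) → P x

NoIsolated : (Cantor → Set) → Set
NoIsolated P = ∀ x → P x → ∀ k →
  Σ Cantor λ y → P y × (∀ m → m < k → y m ≡ x m) × Σ ℕ λ m → ¬ (y m ≡ x m)

NonemptyPerfect : (Cantor → Set) → Set
NonemptyPerfect P = (Σ Cantor P) × Closed P × NoIsolated P

record Setup : Set₁ where
  field
    N      : ℕ → ℕ
    N-zero : N 0 ≡ 0
    N-inc  : ∀ i → N i < N (suc i)
    C      : (i : ℕ) → Block N i → Set
    -- b ∈ C_i + s  iff  b + s ∈ C_i
    C-rich : ∀ i (ss : Fin (suc (N i)) → Block N i) →
               (Σ (Block N i) λ b → ∀ k → C i (b ⊕ ss k))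
             × (Σ (Block N i) λ b → ∀ k → ¬ C i (b ⊕ ss k))
    P      : ℕ → Cantor → Set
    P-perf : ∀ m → NonemptyPerfect (P m)

open Setup public

TStar : (σ : Setup) → ℕ → ∀ {k} → Seq k → Set
TStar σ m {k} u = Σ Cantor λ x → Σ Cantor λ y → P σ m x × P σ m y ×
  (∀ (q : Fin k) → lookup u q ≡ (x (toℕ q) xor y (toℕ q)))

Acceptable : (σ : Setup) → (i : ℕ) → Seq (N σ i) → Set
Acceptable σ i s = ∀ j → (p : j < i) →
  C σ j (slice s (N σ j) (N σ (suc j)) (<⇒≤ (N-inc σ j)) (mono (N σ) (N-inc σ) p))

-- tree mappings with domain n: a strict tree ordering ≺ on {0,…,n-1} (as a
-- Bool-valued relation) with k ≺ ℓ ⇒ k < ℓ, and labels π (only the values on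
-- immediate-predecessor pairs are ever used)
record TreeMapping (n : ℕ) : Set where
  field
    _≺_    : Fin n → Fin n → Bool
    irrefl : ∀ k → ¬ T (k ≺ k)
    trans  : ∀ a b c → T (a ≺ b) → T (b ≺ c) → T (a ≺ c)
    linear : ∀ a b c → T (a ≺ c) → T (b ≺ c) → T (a ≺ b) ⊎ a ≡ b ⊎ T (b ≺ a)
    ≺⇒<    : ∀ a b → T (a ≺ b) → toℕ a < toℕ b
    π      : Fin n → Fin n → ℕ

open TreeMapping public

ImmPred : ∀ {n} → TreeMapping n → Fin n → Fin n → Set
ImmPred tm k ℓ = T (_≺_ tm k ℓ) × (∀ m → ¬ (T (_≺_ tm k m) × T (_≺_ tm m ℓ)))

-- ⟨π, s_0, …, s_(n-1)⟩ ∈ S with i(ρ) = i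
InS : (σ : Setup) → ∀ {n i} → TreeMapping n → (Fin n → Seq (N σ i)) → Set
InS σ {n} {i} tm s =
  1 ≤ n × n ≤ N σ i × (∀ k → Acceptable σ i (s k)) ×
  (∀ k ℓ → ImmPred tm k ℓ → TStar σ (π tm k ℓ) (s k ⊕ s ℓ))

_◁_ : ∀ {d e} → Seq d → Seq e → Set
_◁_ {d} {e} s t = Σ (d < e) λ p → ∀ (q : Fin d) → lookup t (inject≤ q (<⇒≤ p)) ≡ lookup s q

-- Each s_k is first extended to an infinite point w_k ∈ 2^ω, taking the points in
-- increasing order: a ≺-root continues s_k diagonally away from the earlier points,
-- and a node ℓ with immediate predecessor k gets w_ℓ = w_k + x + y′, where x + y
-- witnesses s_k + s_ℓ ∈ T*_π(k,ℓ), and y′ ∈ P_π(k,ℓ) is chosen close to y (P being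
-- perfect) so that w_ℓ differs from all earlier points.  Then every edge satisfies
-- w_k + w_ℓ ∈ P + P, and the w_k are pairwise distinct.  Next, one shift r ∈ 2^ω
-- is chosen, zero below n_i and on each block [n_m, n_(m+1)) with m ≥ i a common
-- translate putting the n ≤ n_m + 1 blocks of all w_k into C_m.  The prefixes
-- t_k = (r + w_k) ↾ n_j then lie in S, since t_k + t_ℓ = (w_k + w_ℓ) ↾ n_j; and they
-- are distinct once n_j exceeds a coordinate separating each pair w_k ≠ w_ℓ.
module Submission where

open import Defs hiding (trans)
open import Data.Nat using (ℕ; zero; suc; _+_; _∸_; _≤_; _<_; _⊔_; z≤n; s≤s; _<?_; _≤?_; _≟_; s≤s⁻¹)
open import Data.Nat.Properties
open import Data.Bool using (true; false; not; _xor_)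
open import Data.Bool.Properties as Bool
  using (xor-assoc; xor-same; not-¬; not-involutive; not-distribˡ-xor; not-distribʳ-xor)
open import Data.Fin using (Fin; toℕ; fromℕ<; inject≤)
open import Data.Fin.Properties
  using (toℕ-fromℕ<; fromℕ<-toℕ; toℕ-inject≤; toℕ<n; toℕ-injective; any?; all?)
  renaming (_≟_ to _≟ᶠ_)
open import Data.Vec using (Vec; lookup; tabulate; replicate)
open import Data.Vec.Properties
  using (lookup∘tabulate; lookup-zipWith; lookup-replicate; tabulate-cong; tabulate∘lookup)
open import Data.Product using (Σ; ∃; _×_; _,_; proj₁; proj₂)
open import Data.Sum using (inj₁; inj₂)
open import Data.Empty using (⊥-elim)
open import Function using (_∘_)
open import Relation.Nullary using (¬_; Dec; yes; no)
open import Relation.Nullary.Decidable using (T?; ¬?; _×-dec_)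
open import Relation.Binary.Definitions using (tri<; tri≈; tri>)
open import Relation.Binary.PropositionalEquality

xor-cancelˡ : ∀ a b → a xor (a xor b) ≡ b
xor-cancelˡ a b = trans (sym (xor-assoc a a b)) (cong (_xor b) (xor-same a))

xor-cancelˡ-≡ : ∀ a {b c} → a xor b ≡ a xor c → b ≡ c
xor-cancelˡ-≡ a {b} {c} eq = trans (sym (xor-cancelˡ a b)) (trans (cong (a xor_) eq) (xor-cancelˡ a c))

xor-cancel-shared : ∀ r a b → (r xor a) xor (r xor b) ≡ a xor b
xor-cancel-shared false a b = refl
xor-cancel-shared true  a b = begin
  not a xor not b     ≡⟨ not-distribˡ-xor a (not b) ⟨
  not (a xor not b)   ≡⟨ cong not (not-distribʳ-xor a b) ⟨
  not (not (a xor b)) ≡⟨ not-involutive (a xor b) ⟩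
  a xor b             ∎
  where open ≡-Reasoning

lookup-ext : ∀ {A : Set} {d} {u v : Vec A d} → (∀ q → lookup u q ≡ lookup v q) → u ≡ v
lookup-ext {u = u} {v} u≗v = trans (sym (tabulate∘lookup u)) (trans (tabulate-cong u≗v) (tabulate∘lookup v))

-- Cantor space and its finite prefixes

_⊕ᶜ_ : Cantor → Cantor → Cantor
(x ⊕ᶜ y) p = x p xor y p

Apart : Cantor → Cantor → Set
Apart x y = ∃ λ d → ¬ (x d ≡ y d)

AgreeBelow : {A : Set} → ℕ → (ℕ → A) → (ℕ → A) → Set
AgreeBelow L x y = ∀ m → m < L → x m ≡ y m

InSumset : (Cantor → Set) → Cantor → Set
InSumset Q z = Σ Cantor λ x → Σ Cantor λ y → Q x × Q y × (z ≗ x ⊕ᶜ y)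

InSumset-shift : ∀ {Q} r {x y} → InSumset Q (x ⊕ᶜ y) → InSumset Q ((r ⊕ᶜ x) ⊕ᶜ (r ⊕ᶜ y))
InSumset-shift r {x} {y} (a , b , Qa , Qb , x⊕y≗a⊕b) =
  a , b , Qa , Qb , λ p → trans (xor-cancel-shared (r p) (x p) (y p)) (x⊕y≗a⊕b p)

_≼_ : ∀ {d} → Seq d → Cantor → Set
u ≼ z = ∀ q → lookup u q ≡ z (toℕ q)

_↾_ : Cantor → (d : ℕ) → Seq d
z ↾ d = tabulate (z ∘ toℕ)

↾-≼ : ∀ z d → (z ↾ d) ≼ z
↾-≼ z d = lookup∘tabulate (z ∘ toℕ)

⊕-≼ : ∀ {d} {u v : Seq d} {x y} → u ≼ x → v ≼ y → (u ⊕ v) ≼ (x ⊕ᶜ y)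
⊕-≼ {u = u} {v} u≼x v≼y q = trans (lookup-zipWith _xor_ q u v) (cong₂ _xor_ (u≼x q) (v≼y q))

≼-◁ : ∀ {d e} {u : Seq d} {z} → u ≼ z → d < e → u ◁ (z ↾ e)
≼-◁ {z = z} u≼z d<e = d<e , λ q →
  trans (↾-≼ z _ (inject≤ q (<⇒≤ d<e))) (trans (cong z (toℕ-inject≤ q (<⇒≤ d<e))) (sym (u≼z q)))

↾-apart : ∀ {x y d e} → d < e → ¬ (x d ≡ y d) → ¬ (x ↾ e ≡ y ↾ e)
↾-apart {x} {y} d<e x≢y eq = x≢y (begin
  x _                          ≡⟨ cong x (toℕ-fromℕ< d<e) ⟨
  x (toℕ (fromℕ< d<e))         ≡⟨ ↾-≼ x _ (fromℕ< d<e) ⟨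
  lookup (x ↾ _) (fromℕ< d<e)  ≡⟨ cong (λ v → lookup v (fromℕ< d<e)) eq ⟩
  lookup (y ↾ _) (fromℕ< d<e)  ≡⟨ ↾-≼ y _ (fromℕ< d<e) ⟩
  y (toℕ (fromℕ< d<e))         ≡⟨ cong y (toℕ-fromℕ< d<e) ⟩
  y _                          ∎)
  where open ≡-Reasoning

_++ᶜ_ : ∀ {d} → Seq d → Cantor → Cantor
(_++ᶜ_ {d} u z) p with p <? d
... | yes p<d = lookup u (fromℕ< p<d)
... | no  _   = z (p ∸ d)

++ᶜ-≼ : ∀ {d} (u : Seq d) z → u ≼ (u ++ᶜ z)
++ᶜ-≼ {d} u z q with toℕ q <? d
... | yes q<d = cong (lookup u) (sym (fromℕ<-toℕ q q<d))
... | no  q≮d = ⊥-elim (q≮d (toℕ<n q))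

++ᶜ-drop : ∀ {d} (u : Seq d) z p → (u ++ᶜ z) (d + p) ≡ z p
++ᶜ-drop {d} u z p with d + p <? d
... | yes d+p<d = ⊥-elim (m+n≮m d p d+p<d)
... | no  _     = cong z (m+n∸m≡n d p)

segment : (N : ℕ → ℕ) → Cantor → (m : ℕ) → Block N m
segment N z m = tabulate λ q → z (N m + toℕ q)

segment-⊕ᶜ : ∀ N x y m → segment N (x ⊕ᶜ y) m ≡ segment N x m ⊕ segment N y m
segment-⊕ᶜ N x y m = lookup-ext λ q →
  trans (lookup∘tabulate _ q)
    (sym (trans (lookup-zipWith _xor_ q (segment N x m) (segment N y m))
                (cong₂ _xor_ (lookup∘tabulate _ q) (lookup∘tabulate _ q))))

slice-≼ : ∀ {d} {u : Seq d} {z} → u ≼ z → ∀ {a b} (a≤b : a ≤ b) (b≤d : b ≤ d) →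
  slice u a b a≤b b≤d ≡ tabulate (λ q → z (a + toℕ q))
slice-≼ {d} {u} {z} u≼z {a} {b} a≤b b≤d = tabulate-cong λ q →
  let a+q<d = slice-lemma a b d q a≤b b≤d in trans (u≼z (fromℕ< a+q<d)) (cong z (toℕ-fromℕ< a+q<d))

-- Perfect sets

module _ {Q : Cantor → Set} (Q-noIsolated : NoIsolated Q) where

  avoid-point : ∀ {y} → Q y → ∀ L v →
    Σ Cantor λ y′ → Q y′ × AgreeBelow L y′ y × Apart y′ v
  avoid-point {y} Qy L v with Q-noIsolated y Qy L
  ... | y₂ , Qy₂ , y₂≈y , m , y₂≢y with y m Bool.≟ v m
  ...   | yes y≡v = y₂ , Qy₂ , y₂≈y , m , λ y₂≡v → y₂≢y (trans y₂≡v (sym y≡v))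
  ...   | no  y≢v = y , Qy , (λ _ _ → refl) , m , y≢v

  -- Separating from the last point first lets the remaining points be avoided
  -- without disturbing the coordinate that separates it.
  avoid-points : ∀ {y} → Q y → ∀ L r (v : ℕ → Cantor) →
    Σ Cantor λ y′ → Q y′ × AgreeBelow L y′ y × (∀ q → q < r → Apart y′ (v q))
  avoid-points Qy L zero v = _ , Qy , (λ _ _ → refl) , λ _ ()
  avoid-points Qy L (suc r) v with avoid-point Qy L (v r)
  ... | y₁ , Qy₁ , y₁≈y , d , y₁≢v with avoid-points Qy₁ (L ⊔ suc d) r v
  ...   | y′ , Qy′ , y′≈y₁ , y′-apart = y′ , Qy′ , y′≈y , y′-apart′
    where
      y′≈y : AgreeBelow L y′ _
      y′≈y m m<L = trans (y′≈y₁ m (m<n⇒m<n⊔o (suc d) m<L)) (y₁≈y m m<L)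
      y′-apart′ : ∀ q → q < suc r → Apart y′ (v q)
      y′-apart′ q q<1+r with m≤n⇒m<n∨m≡n (s≤s⁻¹ q<1+r)
      ... | inj₁ q<r  = y′-apart q q<r
      ... | inj₂ refl = d , λ y′≡v → y₁≢v (trans (sym (y′≈y₁ d (m<n⇒m<o⊔n L (n<1+n d)))) y′≡v)

module _ {A : Set} (Good : (ℕ → A) → ℕ → A → Set)
         (Good-local : ∀ {W W′ c a} → AgreeBelow c W W′ → Good W c a → Good W′ c a) where

  private
    _[_≔_] : (ℕ → A) → ℕ → A → ℕ → A
    (W [ c ≔ a ]) q with q ≟ c
    ... | yes _ = a
    ... | no  _ = W q

    update-here : ∀ W c a → (W [ c ≔ a ]) c ≡ a
    update-here W c a with c ≟ c
    ... | yes _   = refl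
    ... | no  c≢c = ⊥-elim (c≢c refl)

    update-below : ∀ W c a → AgreeBelow c (W [ c ≔ a ]) W
    update-below W c a q q<c with q ≟ c
    ... | yes q≡c = ⊥-elim (<⇒≢ q<c q≡c)
    ... | no  _   = refl

  sequential-choice : A → ∀ n →
    (∀ W c → c < n → (∀ q → q < c → Good W q (W q)) → Σ A (Good W c)) →
    Σ (ℕ → A) λ W → ∀ c → c < n → Good W c (W c)
  sequential-choice a₀ n choose = stage n ≤-refl
    where
      stage : ∀ c → c ≤ n → Σ (ℕ → A) λ W → ∀ q → q < c → Good W q (W q)
      stage zero    _   = (λ _ → a₀) , λ _ ()
      stage (suc c) c<n with stage c (<⇒≤ c<n)
      ... | W , W-good with choose W c c<n W-good
      ...   | a , a-good = W [ c ≔ a ] , W′-good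
        where
          W′-good : ∀ q → q < suc c → Good (W [ c ≔ a ]) q ((W [ c ≔ a ]) q)
          W′-good q q<1+c with m≤n⇒m<n∨m≡n (s≤s⁻¹ q<1+c)
          ... | inj₁ q<c = subst (Good _ q) (sym (update-below W c a q q<c))
                  (Good-local (λ r r<q → sym (update-below W c a r (<-trans r<q q<c))) (W-good q q<c))
          ... | inj₂ refl = subst (Good _ q) (sym (update-here W q a))
                  (Good-local (λ r r<q → sym (update-below W q a r r<q)) a-good)

bounded-witnesses : ∀ {n} {P : Fin n → ℕ → Set} → (∀ k → ∃ (P k)) →
  ∃ λ D → ∀ k → ∃ λ d → d < D × P k d
bounded-witnesses {zero}  _ = 0 , λ ()
bounded-witnesses {suc n} witness with witness Fin.zero | bounded-witnesses (witness ∘ Fin.suc)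
... | d₀ , P₀ | D , bounded = suc d₀ ⊔ D , λ
  { Fin.zero    → d₀ , m<n⇒m<n⊔o D (n<1+n d₀) , P₀
  ; (Fin.suc k) → let d , d<D , Pkd = bounded k in d , m<n⇒m<o⊔n (suc d₀) d<D , Pkd }

apart-bound : ∀ {n} (w : Fin n → Cantor) → (∀ k ℓ → ¬ (k ≡ ℓ) → Apart (w k) (w ℓ)) →
  ∃ λ D → ∀ k ℓ → ¬ (k ≡ ℓ) → ∃ λ d → d < D × ¬ (w k d ≡ w ℓ d)
apart-bound w apart = D , λ k ℓ k≢ℓ →
  let Dₖ , Dₖ<D , row = bounded k ; d , d<Dₖ , w≢w = row ℓ in d , <-trans d<Dₖ Dₖ<D , w≢w k≢ℓ
  where
    pair-witness : ∀ k ℓ → ∃ λ d → ¬ (k ≡ ℓ) → ¬ (w k d ≡ w ℓ d)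
    pair-witness k ℓ with k ≟ᶠ ℓ
    ... | yes k≡ℓ = 0 , λ k≢ℓ → ⊥-elim (k≢ℓ k≡ℓ)
    ... | no  k≢ℓ = let d , w≢w = apart k ℓ k≢ℓ in d , λ _ → w≢w
    rows-bounded = bounded-witnesses λ k → bounded-witnesses (pair-witness k)
    D = proj₁ rows-bounded
    bounded = proj₂ rows-bounded

-- Blocks [n_m, n_(m+1))

module Blocks (N : ℕ → ℕ) (N-zero : N 0 ≡ 0) (N-inc : ∀ m → N m < N (suc m)) where

  N-mono : ∀ {a b} → a ≤ b → N a ≤ N b
  N-mono = mono N N-inc

  N-strictMono : ∀ {a b} → a < b → N a < N b
  N-strictMono {a} a<b = <-≤-trans (N-inc a) (N-mono a<b)

  m≤N : ∀ m → m ≤ N m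
  m≤N zero    = z≤n
  m≤N (suc m) = ≤-trans (s≤s (m≤N m)) (N-inc m)

  blockBelow : ℕ → ℕ → ℕ
  blockBelow p zero = zero
  blockBelow p (suc m) with N (suc m) ≤? p
  ... | yes _ = suc m
  ... | no  _ = blockBelow p m

  blockBelow-start : ∀ p m → N (blockBelow p m) ≤ p
  blockBelow-start p zero    = subst (_≤ p) (sym N-zero) z≤n
  blockBelow-start p (suc m) with N (suc m) ≤? p
  ... | yes N≤p = N≤p
  ... | no  _   = blockBelow-start p m

  blockBelow-end : ∀ p m → p < N (suc m) → p < N (suc (blockBelow p m))
  blockBelow-end p zero    p<N = p<N
  blockBelow-end p (suc m) p<N with N (suc m) ≤? p
  ... | yes _   = p<N
  ... | no  N≰p = blockBelow-end p m (≰⇒> N≰p)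

  blockOf : ℕ → ℕ
  blockOf p = blockBelow p p

  blockOf-start : ∀ p → N (blockOf p) ≤ p
  blockOf-start p = blockBelow-start p p

  blockOf-end : ∀ p → p < N (suc (blockOf p))
  blockOf-end p = blockBelow-end p p (<-≤-trans (n<1+n p) (m≤N (suc p)))

  blockOf-unique : ∀ {p m} → N m ≤ p → p < N (suc m) → blockOf p ≡ m
  blockOf-unique {p} {m} N≤p p<N with <-cmp (blockOf p) m
  ... | tri< b<m _ _ = ⊥-elim (<⇒≱ (blockOf-end p) (≤-trans (N-mono b<m) N≤p))
  ... | tri≈ _ b≡m _ = b≡m
  ... | tri> _ _ m<b = ⊥-elim (<⇒≱ p<N (≤-trans (N-mono m<b) (blockOf-start p)))

  offset : ∀ p → Fin (N (suc (blockOf p)) ∸ N (blockOf p))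
  offset p = fromℕ< (∸-monoˡ-< (blockOf-end p) (blockOf-start p))

  concatBlocks : (∀ m → Block N m) → Cantor
  concatBlocks b p = lookup (b (blockOf p)) (offset p)

  concatBlocks-segment : ∀ b m → segment N (concatBlocks b) m ≡ b m
  concatBlocks-segment b m = lookup-ext λ q →
    trans (lookup∘tabulate _ q) (lookup-block (blockOf-N+q q) (offset (N m + toℕ q)) q (toℕ-offset q))
    where
      blockOf-N+q : (q : Fin (N (suc m) ∸ N m)) → blockOf (N m + toℕ q) ≡ m
      blockOf-N+q q = blockOf-unique (m≤m+n (N m) (toℕ q))
                                     (slice-lemma (N m) (N (suc m)) (N (suc m)) q (<⇒≤ (N-inc m)) ≤-refl)
      toℕ-offset : ∀ q → toℕ (offset (N m + toℕ q)) ≡ toℕ q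
      toℕ-offset q = trans (toℕ-fromℕ< _)
        (trans (cong (λ m′ → N m + toℕ q ∸ N m′) (blockOf-N+q q)) (m+n∸m≡n (N m) (toℕ q)))
      lookup-block : ∀ {m′} → m′ ≡ m →
        (q′ : Fin (N (suc m′) ∸ N m′)) (q : Fin (N (suc m) ∸ N m)) →
        toℕ q′ ≡ toℕ q → lookup (b m′) q′ ≡ lookup (b m) q
      lookup-block refl q′ q q′≡q = cong (lookup (b m)) (toℕ-injective q′≡q)

  concatBlocks-zero : ∀ b i → (∀ m → m < i → b m ≡ replicate _ false) →
    ∀ p → p < N i → concatBlocks b p ≡ false
  concatBlocks-zero b i zero-below p p<N =
    trans (cong (λ v → lookup v (offset p)) (zero-below (blockOf p) blockOf<i)) (lookup-replicate (offset p) false)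
    where
      blockOf<i : blockOf p < i
      blockOf<i = ≰⇒> λ i≤b → <⇒≱ p<N (≤-trans (N-mono i≤b) (blockOf-start p))

module _ (σ : Setup) where

  common-C-shift : ∀ m {r} → r ≤ suc (N σ m) → (u : Fin r → Block (N σ) m) →
    Σ (Block (N σ) m) λ b → ∀ k → C σ m (b ⊕ u k)
  common-C-shift m {r} r≤ u =
    b , λ k → subst (λ v → C σ m (b ⊕ v)) (padded-inject k) (b-good (inject≤ k r≤))
    where
      padded : Fin (suc (N σ m)) → Block (N σ) m
      padded f with toℕ f <? r
      ... | yes f<r = u (fromℕ< f<r)
      ... | no  _   = replicate _ false
      padded-inject : ∀ k → padded (inject≤ k r≤) ≡ u k
      padded-inject k with toℕ (inject≤ k r≤) <? r
      ... | yes k<r = cong u (toℕ-injective (trans (toℕ-fromℕ< k<r) (toℕ-inject≤ k r≤)))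
      ... | no  k≮r = ⊥-elim (k≮r (subst (_< r) (sym (toℕ-inject≤ k r≤)) (toℕ<n k)))
      b = proj₁ (proj₁ (C-rich σ m padded))
      b-good = proj₂ (proj₁ (C-rich σ m padded))

  acceptable-↾ : ∀ j z → (∀ m → m < j → C σ m (segment (N σ) z m)) → Acceptable σ j (z ↾ N σ j)
  acceptable-↾ j z segment-C m m<j =
    subst (C σ m)
      (sym (slice-≼ {u = z ↾ N σ j} {z} (↾-≼ z _) (<⇒≤ (N-inc σ m)) (mono (N σ) (N-inc σ) m<j)))
      (segment-C m m<j)

  acceptable-segment : ∀ {i} {u : Seq (N σ i)} {z} → Acceptable σ i u → u ≼ z →
    ∀ m → m < i → C σ m (segment (N σ) z m)
  acceptable-segment {u = u} {z} u-acc u≼z m m<i =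
    subst (C σ m) (slice-≼ {u = u} {z} u≼z (<⇒≤ (N-inc σ m)) (mono (N σ) (N-inc σ) m<i)) (u-acc m m<i)

  P-noIsolated : ∀ m → NoIsolated (P σ m)
  P-noIsolated m = proj₂ (proj₂ (P-perf σ m))

  InSumset-TStar : ∀ {m d} {u : Seq d} {z} → u ≼ z → InSumset (P σ m) z → TStar σ m u
  InSumset-TStar u≼z (x , y , Px , Py , z≗x⊕y) = x , y , Px , Py , λ q → trans (u≼z q) (z≗x⊕y (toℕ q))

immPred? : ∀ {n} (tm : TreeMapping n) k ℓ → Dec (ImmPred tm k ℓ)
immPred? tm k ℓ = T? (_≺_ tm k ℓ) ×-dec all? (λ m → ¬? (T? (_≺_ tm k m) ×-dec T? (_≺_ tm m ℓ)))

immPred-unique : ∀ {n} (tm : TreeMapping n) {k k′ ℓ} → ImmPred tm k ℓ → ImmPred tm k′ ℓ → k ≡ k′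
immPred-unique tm {k} {k′} {ℓ} (k≺ℓ , k-imm) (k′≺ℓ , k′-imm)
  with linear tm k k′ ℓ k≺ℓ k′≺ℓ
... | inj₁ k≺k′        = ⊥-elim (k-imm k′ (k≺k′ , k′≺ℓ))
... | inj₂ (inj₁ k≡k′) = k≡k′
... | inj₂ (inj₂ k′≺k) = ⊥-elim (k′-imm k (k′≺k , k≺ℓ))

-- Infinite points realising ρ

record Realisation (σ : Setup) {n i} (tm : TreeMapping n) (s : Fin n → Seq (N σ i)) : Set where
  field
    point   : Fin n → Cantor
    extends : ∀ k → s k ≼ point k
    edge    : ∀ k ℓ → ImmPred tm k ℓ → InSumset (P σ (π tm k ℓ)) (point k ⊕ᶜ point ℓ)
    apart   : ∀ k ℓ → ¬ (k ≡ ℓ) → Apart (point k) (point ℓ)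

module _ (σ : Setup) {n i} (tm : TreeMapping n) (s : Fin n → Seq (N σ i))
         (s-edge : ∀ k ℓ → ImmPred tm k ℓ → TStar σ (π tm k ℓ) (s k ⊕ s ℓ)) where

  -- W q is the point already chosen for q; only q < ℓ matters.
  record Admissible (W : ℕ → Cantor) (ℓ : Fin n) (w : Cantor) : Set where
    field
      extends : s ℓ ≼ w
      apart   : ∀ q → q < toℕ ℓ → Apart w (W q)
      edge    : ∀ k → ImmPred tm k ℓ → InSumset (P σ (π tm k ℓ)) (W (toℕ k) ⊕ᶜ w)

  admissible-local : ∀ {W W′ ℓ w} → AgreeBelow (toℕ ℓ) W W′ →
    Admissible W ℓ w → Admissible W′ ℓ w
  admissible-local {ℓ = ℓ} {w} W≈W′ adm = record
    { extends = extends
    ; apart   = λ q q<ℓ → subst (Apart w) (W≈W′ q q<ℓ) (apart q q<ℓ)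
    ; edge    = λ k k⋖ℓ →
        subst (λ v → InSumset _ (v ⊕ᶜ w)) (W≈W′ (toℕ k) (≺⇒< tm k ℓ (proj₁ k⋖ℓ))) (edge k k⋖ℓ)
    }
    where open Admissible adm

  root-point : ∀ W ℓ → (∀ k → ¬ ImmPred tm k ℓ) → Σ Cantor (Admissible W ℓ)
  root-point W ℓ no-pred = s ℓ ++ᶜ diagonal , record
    { extends = ++ᶜ-≼ (s ℓ) diagonal
    ; apart   = λ q _ → N σ i + q , λ w≡W → not-¬ refl (trans (sym w≡W) (++ᶜ-drop (s ℓ) diagonal q))
    ; edge    = λ k k⋖ℓ → ⊥-elim (no-pred k k⋖ℓ)
    }
    where
      diagonal : Cantor
      diagonal q = not (W q (N σ i + q))

  child-point : ∀ W ℓ k → ImmPred tm k ℓ → Admissible W k (W (toℕ k)) → Σ Cantor (Admissible W ℓ)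
  child-point W ℓ k k⋖ℓ k-adm with s-edge k ℓ k⋖ℓ
  ... | x , y , Px , Py , s⊕s≡x⊕y
      with avoid-points (P-noIsolated σ (π tm k ℓ)) Py (N σ i) (toℕ ℓ) (λ q → x ⊕ᶜ (W (toℕ k) ⊕ᶜ W q))
  ... | y′ , Py′ , y′≈y , y′-apart = W (toℕ k) ⊕ᶜ (x ⊕ᶜ y′) , record
    { extends = extends
    ; apart   = apart
    ; edge    = edge
    }
    where
      wₖ = W (toℕ k)

      extends : s ℓ ≼ (wₖ ⊕ᶜ (x ⊕ᶜ y′))
      extends q = sym (begin
        wₖ (toℕ q) xor (x (toℕ q) xor y′ (toℕ q))
          ≡⟨ cong₂ (λ a b → a xor (x (toℕ q) xor b))
                   (sym (Admissible.extends k-adm q)) (y′≈y (toℕ q) (toℕ<n q)) ⟩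
        lookup (s k) q xor (x (toℕ q) xor y (toℕ q))
          ≡⟨ cong (lookup (s k) q xor_) (sym (s⊕s≡x⊕y q)) ⟩
        lookup (s k) q xor lookup (s k ⊕ s ℓ) q
          ≡⟨ cong (lookup (s k) q xor_) (lookup-zipWith _xor_ q (s k) (s ℓ)) ⟩
        lookup (s k) q xor (lookup (s k) q xor lookup (s ℓ) q)
          ≡⟨ xor-cancelˡ (lookup (s k) q) (lookup (s ℓ) q) ⟩
        lookup (s ℓ) q ∎)
        where open ≡-Reasoning

      apart : ∀ q → q < toℕ ℓ → Apart (wₖ ⊕ᶜ (x ⊕ᶜ y′)) (W q)
      apart q q<ℓ with y′-apart q q<ℓ
      ... | d , y′≢ = d , λ w≡W → y′≢ (begin
        y′ d                                        ≡⟨ xor-cancelˡ (x d) (y′ d) ⟨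
        x d xor (x d xor y′ d)                      ≡⟨ cong (x d xor_) (xor-cancelˡ (wₖ d) _) ⟨
        x d xor (wₖ d xor (wₖ d xor (x d xor y′ d))) ≡⟨ cong (λ b → x d xor (wₖ d xor b)) w≡W ⟩
        x d xor (wₖ d xor W q d)                    ∎)
        where open ≡-Reasoning

      edge : ∀ k′ → ImmPred tm k′ ℓ →
        InSumset (P σ (π tm k′ ℓ)) (W (toℕ k′) ⊕ᶜ (wₖ ⊕ᶜ (x ⊕ᶜ y′)))
      edge k′ k′⋖ℓ with immPred-unique tm k⋖ℓ k′⋖ℓ
      ... | refl = x , y′ , Px , Py′ , λ p → xor-cancelˡ (wₖ p) _

  admissible-point : ∀ W ℓ → (∀ k → toℕ k < toℕ ℓ → Admissible W k (W (toℕ k))) →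
    Σ Cantor (Admissible W ℓ)
  admissible-point W ℓ earlier with any? (λ k → immPred? tm k ℓ)
  ... | yes (k , k⋖ℓ) = child-point W ℓ k k⋖ℓ (earlier k (≺⇒< tm k ℓ (proj₁ k⋖ℓ)))
  ... | no  no-pred   = root-point W ℓ λ k k⋖ℓ → no-pred (k , k⋖ℓ)

  realisation : Realisation σ tm s
  realisation = record
    { point   = point
    ; extends = λ k → Admissible.extends (admissible k)
    ; edge    = λ k ℓ k⋖ℓ → Admissible.edge (admissible ℓ) k k⋖ℓ
    ; apart   = apart
    }
    where
      Good : (ℕ → Cantor) → ℕ → Cantor → Set
      Good W c w = ∀ ℓ → toℕ ℓ ≡ c → Admissible W ℓ w

      Good-local : ∀ {W W′ c w} → AgreeBelow c W W′ → Good W c w → Good W′ c w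
      Good-local W≈W′ good ℓ ℓ≡c =
        admissible-local (λ q q<ℓ → W≈W′ q (subst (q <_) ℓ≡c q<ℓ)) (good ℓ ℓ≡c)

      choose : ∀ W c → c < n → (∀ q → q < c → Good W q (W q)) → Σ Cantor (Good W c)
      choose W c c<n earlier = proj₁ chosen , λ ℓ ℓ≡c →
        subst (λ ℓ → Admissible W ℓ (proj₁ chosen)) (toℕ-injective (trans (toℕ-fromℕ< c<n) (sym ℓ≡c)))
          (proj₂ chosen)
        where
          chosen = admissible-point W (fromℕ< c<n) λ k k<c →
            earlier (toℕ k) (subst (toℕ k <_) (toℕ-fromℕ< c<n) k<c) k refl

      points = sequential-choice Good Good-local (λ _ → false) n choose

      point : Fin n → Cantor
      point k = proj₁ points (toℕ k)

      admissible : ∀ k → Admissible (proj₁ points) k (point k)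
      admissible k = proj₂ points (toℕ k) (toℕ<n k) k refl

      apart : ∀ k ℓ → ¬ (k ≡ ℓ) → Apart (point k) (point ℓ)
      apart k ℓ k≢ℓ with <-cmp (toℕ k) (toℕ ℓ)
      ... | tri< k<ℓ _ _ = let d , ℓ≢k = Admissible.apart (admissible ℓ) (toℕ k) k<ℓ in d , ℓ≢k ∘ sym
      ... | tri≈ _ k≡ℓ _ = ⊥-elim (k≢ℓ (toℕ-injective k≡ℓ))
      ... | tri> _ _ ℓ<k = Admissible.apart (admissible k) (toℕ ℓ) ℓ<k

-- The finite extensions

module Extension (σ : Setup) {n i} (tm : TreeMapping n) (s : Fin n → Seq (N σ i))
                 (n≤Nᵢ : n ≤ N σ i) (s-acc : ∀ k → Acceptable σ i (s k))
                 (s-edge : ∀ k ℓ → ImmPred tm k ℓ → TStar σ (π tm k ℓ) (s k ⊕ s ℓ)) where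

  open Realisation (realisation σ tm s s-edge)
  open Blocks (N σ) (N-zero σ) (N-inc σ)

  n≤1+Nₘ : ∀ {m} → ¬ (m < i) → n ≤ suc (N σ m)
  n≤1+Nₘ m≮i = ≤-trans n≤Nᵢ (≤-trans (N-mono (≮⇒≥ m≮i)) (n≤1+n _))

  shiftBlock : ∀ m → Block (N σ) m
  shiftBlock m with m <? i
  ... | yes _   = replicate _ false
  ... | no  m≮i = proj₁ (common-C-shift σ m (n≤1+Nₘ m≮i) λ k → segment (N σ) (point k) m)

  shiftBlock-C : ∀ m → ¬ (m < i) → ∀ k → C σ m (shiftBlock m ⊕ segment (N σ) (point k) m)
  shiftBlock-C m m≮i with m <? i
  ... | yes m<i = ⊥-elim (m≮i m<i)
  ... | no  m≮i = proj₂ (common-C-shift σ m (n≤1+Nₘ m≮i) λ k → segment (N σ) (point k) m)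

  shiftBlock-below : ∀ m → m < i → shiftBlock m ≡ replicate _ false
  shiftBlock-below m m<i with m <? i
  ... | yes _   = refl
  ... | no  m≮i = ⊥-elim (m≮i m<i)

  shift : Cantor
  shift = concatBlocks shiftBlock

  lifted : Fin n → Cantor
  lifted k = shift ⊕ᶜ point k

  s≼lifted : ∀ k → s k ≼ lifted k
  s≼lifted k q =
    trans (extends k q) (cong (_xor point k (toℕ q))
      (sym (concatBlocks-zero shiftBlock i shiftBlock-below (toℕ q) (toℕ<n q))))

  lifted-C : ∀ k m → C σ m (segment (N σ) (lifted k) m)
  lifted-C k m with m <? i
  ... | yes m<i = acceptable-segment σ {u = s k} {lifted k} (s-acc k) (s≼lifted k) m m<i
  ... | no  m≮i = subst (C σ m) (sym segment-lifted) (shiftBlock-C m m≮i k)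
    where
      segment-lifted : segment (N σ) (lifted k) m ≡ shiftBlock m ⊕ segment (N σ) (point k) m
      segment-lifted = trans (segment-⊕ᶜ (N σ) shift (point k) m)
                             (cong (_⊕ segment (N σ) (point k) m) (concatBlocks-segment shiftBlock m))

  t : ∀ j → Fin n → Seq (N σ j)
  t j k = lifted k ↾ N σ j

  t-extends : ∀ j → i < j → ∀ k → s k ◁ t j k
  t-extends j i<j k = ≼-◁ {u = s k} {lifted k} (s≼lifted k) (N-strictMono i<j)

  t∈S : ∀ j → i < j → 1 ≤ n → InS σ tm (t j)
  t∈S j i<j 1≤n =
    1≤n , ≤-trans n≤Nᵢ (N-mono (<⇒≤ i<j)) ,
    (λ k → acceptable-↾ σ j (lifted k) λ m _ → lifted-C k m) ,
    λ k ℓ k⋖ℓ → InSumset-TStar σ {u = t j k ⊕ t j ℓ} {lifted k ⊕ᶜ lifted ℓ}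
      (⊕-≼ {u = t j k} {t j ℓ} {lifted k} {lifted ℓ} (↾-≼ (lifted k) _) (↾-≼ (lifted ℓ) _))
      (InSumset-shift shift (edge k ℓ k⋖ℓ))

  D : ℕ
  D = proj₁ (apart-bound point apart)

  t-injective : ∀ j → D ≤ j → ∀ k ℓ → ¬ (k ≡ ℓ) → ¬ (t j k ≡ t j ℓ)
  t-injective j D≤j k ℓ k≢ℓ with proj₂ (apart-bound point apart) k ℓ k≢ℓ
  ... | d , d<D , point≢point =
    ↾-apart (<-≤-trans d<D (≤-trans D≤j (m≤N j))) (point≢point ∘ xor-cancelˡ-≡ (shift d))

lemma2p3 : (σ : Setup) → ∀ {n i} (tm : TreeMapping n) (s : Fin n → Seq (N σ i)) →
    InS σ tm s →
      (∀ j → i < j → Σ (Fin n → Seq (N σ j)) λ t → (∀ k → s k ◁ t k) × InS σ tm t)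
    × (Σ ℕ λ J → ∀ j → i < j → J ≤ j →
         Σ (Fin n → Seq (N σ j)) λ t → (∀ k → s k ◁ t k) × InS σ tm t ×
           (∀ k ℓ → ¬ (k ≡ ℓ) → ¬ (t k ≡ t ℓ)))
lemma2p3 σ tm s (1≤n , n≤Nᵢ , s-acc , s-edge) =
  (λ j i<j → t j , t-extends j i<j , t∈S j i<j 1≤n) ,
  (D , λ j i<j D≤j → t j , t-extends j i<j , t∈S j i<j 1≤n , t-injective j D≤j)
  where open Extension σ tm s n≤Nᵢ s-acc s-edge
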